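{- $\delta$ mutually exchanges $\Sigma^2$ and $\Sigma_2$, i.e. $\delta(\Sigma^2) = \Sigma_2$ and $\delta(\Sigma_2) = \Sigma^2$.
   Context: Here $SL_2(\mathbb{N})$ denotes the set of $2\times 2$ matrices with non-negative integer entries and determinant $1$, and $\delta: SL_2(\mathbb{N}) \to SL_2(\mathbb{N})$ is the main-diagonal flip $$\delta\begin{pmatrix} b_{11} & b_{12} \\ b_{21} & b_{22}\end{pmatrix} := \begin{pmatrix} b_{22} & b_{12} \\ b_{21} & b_{11}\end{pmatrix}.$$ With $R = \begin{pmatrix} 1 & 1 \\ 0 & 1\end{pmatrix}$, $$\Sigma^2 = \left\{ R \cdot \begin{pmatrix} 2 b_{11} & b_{12} \\ b_{21} & b_{22}\end{pmatrix} \;\middle|\; b_{ij} \in \mathbb{N},\ 2 b_{11} b_{22} - b_{12} b_{21} = 1 \right\},\quad \Sigma_2 = \left\{ \begin{pmatrix} b_{11} & b_{12} \\ b_{21} & 2 b_{22}\end{pmatrix} \cdot R \;\middle|\; b_{ij} \in \mathbb{N},\ 2 b_{11} b_{22} - b_{12} b_{21} = 1 \right\}.$$ -}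

module Defs where

open import Data.Nat using (ℕ; _+_; _*_)
open import Data.Product using (Σ; ∃; _×_; _,_)
open import Relation.Binary.PropositionalEquality using (_≡_)

record Mat : Set where
  constructor mat
  field
    m11 m12 m21 m22 : ℕ

open Mat public

_⊗_ : Mat → Mat → Mat
mat a b c d ⊗ mat e f g h = mat (a * e + b * g) (a * f + b * h) (c * e + d * g) (c * f + d * h)

-- determinant 1, stated in ℕ:  a d - b c = 1  ⇔  a d = 1 + b c
Det1 : Mat → Set
Det1 (mat a b c d) = a * d ≡ 1 + b * c

SL2ℕ : Set
SL2ℕ = Σ Mat Det1

R : Mat
R = mat 1 1 0 1

δ : Mat → Mat
δ (mat a b c d) = mat d b c a

Cond : ℕ → ℕ → ℕ → ℕ → Set
Cond b11 b12 b21 b22 = 2 * b11 * b22 ≡ 1 + b12 * b21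

Σ² : Mat → Set
Σ² M = Σ ℕ λ b11 → Σ ℕ λ b12 → Σ ℕ λ b21 → Σ ℕ λ b22 →
         Cond b11 b12 b21 b22 × M ≡ R ⊗ mat (2 * b11) b12 b21 b22

Σ₂ : Mat → Set
Σ₂ M = Σ ℕ λ b11 → Σ ℕ λ b12 → Σ ℕ λ b21 → Σ ℕ λ b22 →
         Cond b11 b12 b21 b22 × M ≡ mat b11 b12 b21 (2 * b22) ⊗ R

Image : (Mat → Mat) → (Mat → Set) → Mat → Set
Image f S M = ∃ λ N → S N × f N ≡ M

-- δ is an involution with δ (R · M) = δ M · R, and the condition 2 b11 b22 − b12 b21 = 1 is
-- symmetric in b11 and b22; so δ maps Σ² into Σ₂ and Σ₂ into Σ², and being an involution it
-- maps each onto the other.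
module Submission where

open import Defs
open import Data.Nat using (_+_; _*_)
open import Data.Nat.Properties using (*-commutativeSemigroup)
open import Data.Nat.Tactic.RingSolver using (solve-∀)
open import Algebra.Properties.CommutativeSemigroup *-commutativeSemigroup
  using (xy∙z≈xz∙y)
open import Data.Product using (_×_; _,_)
open import Function.Bundles using (_⇔_; mk⇔)
open import Relation.Binary.PropositionalEquality using (_≡_; refl; sym; trans; cong)

module _ {S T : Mat → Set} (f : Mat → Mat) (f-involutive : ∀ M → f (f M) ≡ M)
         (S⇒T : ∀ {M} → S M → T (f M)) (T⇒S : ∀ {M} → T M → S (f M)) where

  image-involution⇔ : ∀ M → Image f S M ⇔ T M
  image-involution⇔ M = mk⇔ to from
    where
    to : Image f S M → T M
    to (N , sN , refl) = S⇒T sN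

    from : T M → Image f S M
    from tM = f M , T⇒S tM , f-involutive M

δ-involutive : ∀ M → δ (δ M) ≡ M
δ-involutive (mat a b c d) = refl

mat-cong : ∀ {a b c d a′ b′ c′ d′} →
           a ≡ a′ → b ≡ b′ → c ≡ c′ → d ≡ d′ → mat a b c d ≡ mat a′ b′ c′ d′
mat-cong refl refl refl refl = refl

δ-R⊗ : ∀ M → δ (R ⊗ M) ≡ δ M ⊗ R
δ-R⊗ (mat a b c d) = mat-cong (corner b d) (sum b d) (corner a c) (sum a c)
  where
  corner : ∀ x y → 0 * x + 1 * y ≡ y * 1 + x * 0
  corner = solve-∀
  sum : ∀ x y → 1 * x + 1 * y ≡ y * 1 + x * 1
  sum = solve-∀

δ-⊗R : ∀ M → δ (M ⊗ R) ≡ R ⊗ δ M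
δ-⊗R (mat a b c d) = sym (cong δ (δ-R⊗ (mat d b c a)))

Cond-swap : ∀ a b c d → Cond a b c d → Cond d b c a
Cond-swap a _ _ d h = trans (xy∙z≈xz∙y 2 d a) h

Σ²⇒δΣ₂ : ∀ {M} → Σ² M → Σ₂ (δ M)
Σ²⇒δΣ₂ (a , b , c , d , h , refl) =
  d , b , c , a , Cond-swap a b c d h , δ-R⊗ (mat (2 * a) b c d)

Σ₂⇒δΣ² : ∀ {M} → Σ₂ M → Σ² (δ M)
Σ₂⇒δΣ² (a , b , c , d , h , refl) =
  d , b , c , a , Cond-swap a b c d h , δ-⊗R (mat a b c (2 * d))

lemma2 : ((M : Mat) → Image δ Σ² M ⇔ Σ₂ M)
         × ((M : Mat) → Image δ Σ₂ M ⇔ Σ² M)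
lemma2 = image-involution⇔ δ δ-involutive Σ²⇒δΣ₂ Σ₂⇒δΣ²
       , image-involution⇔ δ δ-involutive Σ₂⇒δΣ² Σ²⇒δΣ₂
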